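{- If $r,s\geq 2$ are integers, then \[ \operatorname{CR}^2(\diamond_r,\diamond_s)\leq 2\left\lfloor \frac{\sqrt{1+8(r-1)(s-1)}-1}{2}\right\rfloor+3(r+s)-1. \]
   Context: The $r$-diamond $\diamond_r$ is the Hasse diagram of the poset $\{x,y_1,\dots,y_r,z\}$ with $x\le y_i\le z$ for all $i$: a 2-uniform pograph with edges $xy_i$ and $y_iz$ (but not $xz$). Given a coloring of the comparable pairs of a poset $Q$, a copy of $H$ in color $i$ is an injection $f:V(H)\to Q$ with $f(x)\le f(y)$ whenever $x\le y$ such that every edge of $H$ is mapped to a pair of color $i$. $\operatorname{CR}^2(G_1,G_2)$ is the least $N$ such that every 2-coloring of the comparable pairs of the $N$-element chain $C_N$ contains a copy of $G_1$ in color 1 or a copy of $G_2$ in color 2. -}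

module Defs where

open import Data.Nat using (ℕ; suc; _+_; _*_; _∸_; _≤_; _<_)
open import Data.Fin using (Fin; toℕ)
open import Data.Bool using (Bool; true; false)
open import Data.Product using (Σ; _×_; _,_)
open import Data.Sum using (_⊎_)
open import Relation.Binary.PropositionalEquality using (_≡_)
open import Function.Definitions using (Injective)

-- The N-element chain C_N is Fin N ordered by toℕ.
-- A 2-colouring of the comparable pairs of C_N: the colour of the pair {a,b}
-- with a < b is  c a b ; values of c on other arguments are irrelevant
-- (an injective order-preserving map only ever uses pairs a < b).
Colouring : ℕ → Set
Colouring N = Fin N → Fin N → Bool

data DiamondV (r : ℕ) : Set where
  bot : DiamondV r
  mid : Fin r → DiamondV r
  top : DiamondV r

-- A copy of the r-diamond in colour col inside C_N under colouring c:
-- an injection f : V(⋄_r) → C_N with f x ≤ f y_i ≤ f z (the poset relations;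
-- x ≤ z follows by transitivity), and every edge x y_i, y_i z coloured col.
record DiamondCopy (r N : ℕ) (c : Colouring N) (col : Bool) : Set where
  field
    f      : DiamondV r → Fin N
    inj    : Injective _≡_ _≡_ f
    mono₁  : ∀ i → toℕ (f bot) ≤ toℕ (f (mid i))
    mono₂  : ∀ i → toℕ (f (mid i)) ≤ toℕ (f top)
    edge₁  : ∀ i → c (f bot) (f (mid i)) ≡ col
    edge₂  : ∀ i → c (f (mid i)) (f top) ≡ col

Arrows : ℕ → ℕ → ℕ → Set
Arrows r s N = (c : Colouring N) → DiamondCopy r N c true ⊎ DiamondCopy s N c false

-- CR²(⋄_r,⋄_s) ≤ B  iff some N ≤ B has the arrowing property
-- (CR² is the least such N).
CR²≤ : ℕ → ℕ → ℕ → Set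
CR²≤ r s B = Σ ℕ (λ N → N ≤ B × Arrows r s N)

-- k = ⌊(√(1+8m) − 1)/2⌋ is characterised (for m : ℕ) as the unique natural
-- number with k(k+1) ≤ 2m < (k+1)(k+2).
IsTriFloor : ℕ → ℕ → Set
IsTriFloor m k = (k * suc k ≤ 2 * m) × (2 * m < suc k * suc (suc k))

-- Suppose a colouring of C_N has no red (true) r-diamond and no blue (false) s-diamond, and put
-- a = r − 1, b = s − 1: then every pair x < z has at most a red and at most b blue monochromatic middles.
-- Sort the inner points y of the chain by the colours of the pairs (0, y) and (y, N − 1): at
-- most a are red–red and at most b blue–blue.  List the red–blue ones as y₀ < … < y_{p−1} and
-- double count the blue pairs among them.  Below y_j at most a pairs are red (each closes a red
-- path from 0), so at least j − a are blue; above y_i at most b pairs are blue (each opens a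
-- blue path to N − 1) and there are only p − 1 − i points at all.  Hence
-- Σ_{t<p} (t ∸ a) ≤ Σ_{t<p} min(b, t), which forces p ≤ a + b + k + 1 when 2ab < (k+1)(k+2);
-- the blue–red points are bounded symmetrically.  Altogether N − 2 ≤ 3(a + b) + 2k + 2.
module Submission where

open import Defs
open import Data.Nat using (ℕ; _+_; _*_; _∸_; _≤_)
open import Data.Nat.Base using (zero; suc; _<_; _⊓_; z≤n; s≤s; s≤s⁻¹; z<s; NonZero)
open import Data.Nat.Properties hiding (_≟_)
open import Data.Nat.DivMod using (_mod_; m<n⇒m%n≡m)
open import Data.Nat.Tactic.RingSolver using (solve-∀)
open import Data.Bool.Base using (Bool; true; false; not; if_then_else_)
open import Data.Bool.Properties using (_≟_; ∧-identityʳ; ¬-not; not-involutive)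
open import Data.Fin.Base using (Fin; zero; suc; toℕ; inject≤)
open import Data.Fin.Properties using (inject≤-injective; toℕ-fromℕ<)
open import Data.Product using (Σ-syntax; _×_; _,_; proj₁; proj₂; map₁; uncurry)
open import Data.Sum using (_⊎_; inj₁; inj₂)
open import Function.Base using (_∘_)
open import Function.Definitions using (Injective)
open import Level using (0ℓ)
open import Relation.Binary.PropositionalEquality
open import Relation.Nullary using (Dec; yes; no; ¬_; does; _×-dec_; ¬?; contradiction)
open import Relation.Nullary.Decidable using (dec-true; dec-false)
open import Relation.Unary using (Pred; Decidable)

sum< : ℕ → (ℕ → ℕ) → ℕ
sum< zero    f = 0
sum< (suc n) f = f n + sum< n f

infixl 10 sum<
syntax sum< n (λ i → x) = ∑[ i < n ] x

∑-cong : ∀ n {f g} → (∀ {i} → i < n → f i ≡ g i) → sum< n f ≡ sum< n g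
∑-cong zero    _   = refl
∑-cong (suc n) f≡g = cong₂ _+_ (f≡g ≤-refl) (∑-cong n (f≡g ∘ m<n⇒m<1+n))

∑-mono-≤ : ∀ n {f g} → (∀ {i} → i < n → f i ≤ g i) → sum< n f ≤ sum< n g
∑-mono-≤ zero    _   = z≤n
∑-mono-≤ (suc n) f≤g = +-mono-≤ (f≤g ≤-refl) (∑-mono-≤ n (f≤g ∘ m<n⇒m<1+n))

∑-const : ∀ n c → ∑[ i < n ] c ≡ n * c
∑-const zero    c = refl
∑-const (suc n) c = cong (c +_) (∑-const n c)

∑-zero : ∀ n {f} → (∀ {i} → i < n → f i ≡ 0) → sum< n f ≡ 0
∑-zero n f≡0 = trans (∑-cong n f≡0) (trans (∑-const n 0) (*-zeroʳ n))

∑-distrib-+ : ∀ n f g → ∑[ i < n ] (f i + g i) ≡ sum< n f + sum< n g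
∑-distrib-+ zero    f g = refl
∑-distrib-+ (suc n) f g = begin
  f n + g n + ∑[ i < n ] (f i + g i)  ≡⟨ cong (f n + g n +_) (∑-distrib-+ n f g) ⟩
  f n + g n + (sum< n f + sum< n g)   ≡⟨ middle-swap (f n) (g n) (sum< n f) (sum< n g) ⟩
  f n + sum< n f + (g n + sum< n g)   ∎
  where
  open ≡-Reasoning
  middle-swap : ∀ w x y z → w + x + (y + z) ≡ w + y + (x + z)
  middle-swap = solve-∀

∑-comm : ∀ m n (f : ℕ → ℕ → ℕ) → ∑[ i < m ] ∑[ j < n ] f i j ≡ ∑[ j < n ] ∑[ i < m ] f i j
∑-comm zero    n f = sym (∑-zero n (λ _ → refl))
∑-comm (suc m) n f = trans (cong (∑[ j < n ] f m j +_) (∑-comm m n f))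
                           (sym (∑-distrib-+ n (f m) (λ j → ∑[ i < m ] f i j)))

∑-split : ∀ m n f → sum< (m + n) f ≡ sum< m f + ∑[ i < n ] f (m + i)
∑-split m zero    f = trans (cong (λ k → sum< k f) (+-identityʳ m)) (sym (+-identityʳ _))
∑-split m (suc n) f = begin
  sum< (m + suc n) f                             ≡⟨ cong (λ k → sum< k f) (+-suc m n) ⟩
  f (m + n) + sum< (m + n) f                     ≡⟨ cong (f (m + n) +_) (∑-split m n f) ⟩
  f (m + n) + (sum< m f + ∑[ i < n ] f (m + i))  ≡⟨ left-swap (f (m + n)) (sum< m f) _ ⟩
  sum< m f + (f (m + n) + ∑[ i < n ] f (m + i))  ∎
  where
  open ≡-Reasoning
  left-swap : ∀ x y z → x + (y + z) ≡ y + (x + z)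
  left-swap = solve-∀

∑-suc : ∀ n f → sum< (suc n) f ≡ f 0 + ∑[ i < n ] f (suc i)
∑-suc n f = trans (∑-split 1 n f) (cong (_+ ∑[ i < n ] f (suc i)) (+-identityʳ (f 0)))

∑-truncate : ∀ {m n f} → m ≤ n → (∀ {i} → m ≤ i → f i ≡ 0) → sum< n f ≡ sum< m f
∑-truncate {m} {n} {f} m≤n f≡0 = begin
  sum< n f                             ≡⟨ cong (λ k → sum< k f) (m+[n∸m]≡n m≤n) ⟨
  sum< (m + (n ∸ m)) f                 ≡⟨ ∑-split m (n ∸ m) f ⟩
  sum< m f + ∑[ i < n ∸ m ] f (m + i)  ≡⟨ cong (sum< m f +_) (∑-zero (n ∸ m) (λ _ → f≡0 (m≤m+n m _))) ⟩
  sum< m f + 0                         ≡⟨ +-identityʳ _ ⟩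
  sum< m f                             ∎
  where open ≡-Reasoning

∑-reverse : ∀ n f → ∑[ i < n ] f (n ∸ suc i) ≡ sum< n f
∑-reverse zero    f = refl
∑-reverse (suc n) f = begin
  f (n ∸ n) + ∑[ i < n ] f (n ∸ i)      ≡⟨ cong₂ _+_ (cong f (n∸n≡0 n)) (∑-cong n (cong f ∘ +-∸-assoc 1)) ⟩
  f 0 + ∑[ i < n ] f (suc (n ∸ suc i))  ≡⟨ cong (f 0 +_) (∑-reverse n (f ∘ suc)) ⟩
  f 0 + ∑[ i < n ] f (suc i)            ≡⟨ ∑-suc n f ⟨
  sum< (suc n) f                        ∎
  where open ≡-Reasoning

∑-id-closed : ∀ n → 2 * ∑[ i < n ] i + n ≡ n * n
∑-id-closed zero    = refl
∑-id-closed (suc n) = begin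
  2 * (n + ∑[ i < n ] i) + suc n      ≡⟨ rearrange n (∑[ i < n ] i) ⟩
  (2 * ∑[ i < n ] i + n) + 2 * n + 1  ≡⟨ cong (λ x → x + 2 * n + 1) (∑-id-closed n) ⟩
  n * n + 2 * n + 1                   ≡⟨ square-suc n ⟩
  suc n * suc n                       ∎
  where
  open ≡-Reasoning
  rearrange : ∀ n s → 2 * (n + s) + suc n ≡ (2 * s + n) + 2 * n + 1
  rearrange = solve-∀
  square-suc : ∀ n → n * n + 2 * n + 1 ≡ suc n * suc n
  square-suc = solve-∀

∑-∸-closed : ∀ a m → 2 * ∑[ t < a + suc m ] (t ∸ a) ≡ m * suc m
∑-∸-closed a m = begin
  2 * ∑[ t < a + suc m ] (t ∸ a)  ≡⟨ cong (2 *_) shift ⟩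
  2 * (m + ∑[ i < m ] i)          ≡⟨ rearrange m (∑[ i < m ] i) ⟩
  m + (2 * ∑[ i < m ] i + m)      ≡⟨ cong (m +_) (∑-id-closed m) ⟩
  m + m * m                       ≡⟨ *-suc m m ⟨
  m * suc m                       ∎
  where
  open ≡-Reasoning
  shift : ∑[ t < a + suc m ] (t ∸ a) ≡ ∑[ i < suc m ] i
  shift = trans (∑-split a (suc m) (_∸ a))
                (cong₂ _+_ (∑-zero a (m≤n⇒m∸n≡0 ∘ <⇒≤)) (∑-cong (suc m) (λ {i} _ → m+n∸m≡n a i)))
  rearrange : ∀ m s → 2 * (m + s) ≡ m + (2 * s + m)
  rearrange = solve-∀

∑-⊓-closed : ∀ b j → 2 * ∑[ t < b + j ] (b ⊓ t) + b ≡ b * b + 2 * (j * b)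
∑-⊓-closed b j = begin
  2 * ∑[ t < b + j ] (b ⊓ t) + b                            ≡⟨ cong (λ x → 2 * x + b) (∑-split b j (b ⊓_)) ⟩
  2 * (∑[ t < b ] (b ⊓ t) + ∑[ i < j ] (b ⊓ (b + i))) + b  ≡⟨ cong₂ (λ x y → 2 * (x + y) + b) below-b above-b ⟩
  2 * (∑[ t < b ] t + j * b) + b                            ≡⟨ rearrange (∑[ t < b ] t) (j * b) b ⟩
  (2 * ∑[ t < b ] t + b) + 2 * (j * b)                      ≡⟨ cong (_+ 2 * (j * b)) (∑-id-closed b) ⟩
  b * b + 2 * (j * b)                                       ∎
  where
  open ≡-Reasoning
  below-b : ∑[ t < b ] (b ⊓ t) ≡ ∑[ t < b ] t
  below-b = ∑-cong b (m≥n⇒m⊓n≡n ∘ <⇒≤)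
  above-b : ∑[ i < j ] (b ⊓ (b + i)) ≡ j * b
  above-b = trans (∑-cong j (λ {i} _ → m≤n⇒m⊓n≡m (m≤m+n b i))) (∑-const j b)
  rearrange : ∀ s x b → 2 * (s + x) + b ≡ (2 * s + b) + 2 * x
  rearrange = solve-∀

∑∸≤∑⊓⇒c[1+c]≤2ab : ∀ a b c → let p = a + suc (b + c) in
  ∑[ t < p ] (t ∸ a) ≤ ∑[ t < p ] (b ⊓ t) → c * suc c ≤ 2 * (a * b)
∑∸≤∑⊓⇒c[1+c]≤2ab a b c sums = +-cancelˡ-≤ common _ _ (begin
  common + c * suc c                        ≡⟨ lower-form b c ⟩
  (b + c) * suc (b + c) + b                 ≡⟨ cong (_+ b) (∑-∸-closed a (b + c)) ⟨
  2 * ∑[ t < a + suc (b + c) ] (t ∸ a) + b  ≤⟨ +-monoˡ-≤ b (*-monoʳ-≤ 2 sums) ⟩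
  2 * ∑[ t < a + suc (b + c) ] (b ⊓ t) + b  ≡⟨ cong (λ p → 2 * ∑[ t < p ] (b ⊓ t) + b) (regroup a b c) ⟩
  2 * ∑[ t < b + (a + suc c) ] (b ⊓ t) + b  ≡⟨ ∑-⊓-closed b (a + suc c) ⟩
  b * b + 2 * ((a + suc c) * b)             ≡⟨ upper-form a b c ⟩
  common + 2 * (a * b)                      ∎)
  where
  open ≤-Reasoning
  common = b * b + 2 * (suc c * b)
  lower-form : ∀ b c → b * b + 2 * (suc c * b) + c * suc c ≡ (b + c) * suc (b + c) + b
  lower-form = solve-∀
  regroup : ∀ a b c → a + suc (b + c) ≡ b + (a + suc c)
  regroup = solve-∀
  upper-form : ∀ a b c → b * b + 2 * ((a + suc c) * b) ≡ b * b + 2 * (suc c * b) + 2 * (a * b)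
  upper-form = solve-∀

-- The excess c = p − (a + b + 1) satisfies c(c + 1) ≤ 2ab < (k + 1)(k + 2), hence c ≤ k.
∑∸≤∑⊓⇒p≤a+b+1+k : ∀ {a b k p} → 2 * (a * b) < suc k * suc (suc k) →
  ∑[ t < p ] (t ∸ a) ≤ ∑[ t < p ] (b ⊓ t) → p ≤ a + b + suc k
∑∸≤∑⊓⇒p≤a+b+1+k {a} {b} {k} {p} ab<k₁k₂ sums with p ≤? a + b + suc k
... | yes p≤ = p≤
... | no p≰ with m≤n⇒∃[o]m+o≡n (≰⇒> p≰)
...   | o , refl = contradiction (≤-trans k₁k₂≤c₁c₂ c₁c₂≤ab) (<⇒≱ ab<k₁k₂)
  where
  c = suc k + o
  regroup : ∀ a b k o → suc (a + b + suc k + o) ≡ a + suc (b + (suc k + o))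
  regroup = solve-∀
  c₁c₂≤ab : c * suc c ≤ 2 * (a * b)
  c₁c₂≤ab = ∑∸≤∑⊓⇒c[1+c]≤2ab a b c
    (subst (λ p → ∑[ t < p ] (t ∸ a) ≤ ∑[ t < p ] (b ⊓ t)) (regroup a b k o) sums)
  k₁k₂≤c₁c₂ : suc k * suc (suc k) ≤ c * suc c
  k₁k₂≤c₁c₂ = *-mono-≤ (m≤m+n (suc k) o) (s≤s (m≤m+n (suc k) o))

𝟙 : {A : Set} → Dec A → ℕ
𝟙 a? = if does a? then 1 else 0

module _ {A : Set} (a? : Dec A) where

  𝟙-yes : A → 𝟙 a? ≡ 1
  𝟙-yes a rewrite dec-true a? a = refl

  𝟙-no : ¬ A → 𝟙 a? ≡ 0
  𝟙-no ¬a rewrite dec-false a? ¬a = refl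

module _ {A B : Set} where

  𝟙-mono : (a? : Dec A) (b? : Dec B) → (A → B) → 𝟙 a? ≤ 𝟙 b?
  𝟙-mono (no _)  _       _   = z≤n
  𝟙-mono (yes _) (yes _) _   = ≤-refl
  𝟙-mono (yes a) (no ¬b) a→b = contradiction (a→b a) ¬b

  𝟙-split : (a? : Dec A) (b? : Dec B) → 𝟙 a? ≡ 𝟙 (a? ×-dec b?) + 𝟙 (a? ×-dec ¬? b?)
  𝟙-split (no _)  _       = refl
  𝟙-split (yes _) (yes _) = refl
  𝟙-split (yes _) (no _)  = refl

  𝟙-×-yes : (a? : Dec A) (b? : Dec B) → B → 𝟙 (a? ×-dec b?) ≡ 𝟙 a?
  𝟙-×-yes a? b? b rewrite dec-true b? b | ∧-identityʳ (does a?) = refl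

module _ {A : Set} {x y : ℕ} where

  𝟙*-≤ : (a? : Dec A) → (A → x ≤ y) → 𝟙 a? * x ≤ y
  𝟙*-≤ (yes a) x≤y = ≤-trans (≤-reflexive (*-identityˡ x)) (x≤y a)
  𝟙*-≤ (no _)  _   = z≤n

  ≤-𝟙* : (a? : Dec A) → (A → x ≤ y) → (¬ A → x ≡ 0) → x ≤ 𝟙 a? * y
  ≤-𝟙* (yes a) x≤y _   = ≤-trans (x≤y a) (≤-reflexive (sym (*-identityˡ y)))
  ≤-𝟙* (no ¬a) _   x≡0 = ≤-reflexive (x≡0 ¬a)

count : {P : Pred ℕ 0ℓ} → Decidable P → ℕ → ℕ
count P? n = ∑[ i < n ] 𝟙 (P? i)

count-mono : {P Q : Pred ℕ 0ℓ} (P? : Decidable P) (Q? : Decidable Q) →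
  (∀ {i} → P i → Q i) → ∀ n → count P? n ≤ count Q? n
count-mono P? Q? P⊆Q n = ∑-mono-≤ n (λ {i} _ → 𝟙-mono (P? i) (Q? i) P⊆Q)

module _ {P : Pred ℕ 0ℓ} (P? : Decidable P) where

  count-none : (∀ {i} → ¬ P i) → ∀ n → count P? n ≡ 0
  count-none ¬P n = ∑-zero n (λ {i} _ → 𝟙-no (P? i) ¬P)

  count-split : {R : Pred ℕ 0ℓ} (R? : Decidable R) → ∀ n →
    count P? n ≡ count (λ i → P? i ×-dec R? i) n + count (λ i → P? i ×-dec ¬? (R? i)) n
  count-split R? n = trans (∑-cong n (λ {i} _ → 𝟙-split (P? i) (R? i))) (∑-distrib-+ n _ _)

  count-below : ∀ {m n} → m ≤ n → count (λ i → P? i ×-dec i <? m) n ≡ count P? m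
  count-below {m} m≤n = trans
    (∑-truncate m≤n (λ {i} m≤i → 𝟙-no (P? i ×-dec i <? m) (λ (_ , i<m) → <⇒≱ i<m m≤i)))
    (∑-cong m (λ {i} i<m → 𝟙-×-yes (P? i) (i <? m) i<m))

  count-by-cases : {Q R S : Pred ℕ 0ℓ} (R? : Decidable R) (Q? : Decidable Q) (S? : Decidable S) →
    (∀ {i} → P i → R i → Q i) → (∀ {i} → P i → ¬ R i → S i) →
    ∀ n → count P? n ≤ count Q? n + count S? n
  count-by-cases R? Q? S? PR⊆Q P¬R⊆S n = begin
    count P? n                       ≡⟨ count-split R? n ⟩
    count P∧R? n + count P∧¬R? n     ≤⟨ +-mono-≤ (count-mono P∧R? Q? (uncurry PR⊆Q) n)
                                                 (count-mono P∧¬R? S? (uncurry P¬R⊆S) n) ⟩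
    count Q? n + count S? n          ∎
    where
    open ≤-Reasoning
    P∧R? P∧¬R? : Decidable _
    P∧R?  i = P? i ×-dec R? i
    P∧¬R? i = P? i ×-dec ¬? (R? i)

count-positive : ∀ n → count (0 <?_) n ≡ n ∸ 1
count-positive zero          = refl
count-positive (suc zero)    = refl
count-positive (suc (suc n)) = cong suc (count-positive (suc n))

∑-members-by-rank : {M : Pred ℕ 0ℓ} (M? : Decidable M) (h : ℕ → ℕ) → ∀ m →
  ∑[ j < m ] (𝟙 (M? j) * h (count M? j)) ≡ ∑[ t < count M? m ] h t
∑-members-by-rank M? h zero    = refl
∑-members-by-rank M? h (suc m) with M? m
... | yes _ = cong₂ _+_ (*-identityˡ _) (∑-members-by-rank M? h m)
... | no _  = ∑-members-by-rank M? h m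

Enumeration : Pred ℕ 0ℓ → ℕ → ℕ → Set
Enumeration P m n = Σ[ g ∈ (Fin m → ℕ) ] Injective _≡_ _≡_ g × (∀ i → g i < n × P (g i))

enumerate : {P : Pred ℕ 0ℓ} (P? : Decidable P) → ∀ n → Enumeration P (count P? n) n
enumerate P? zero = (λ ()) , (λ {}) , (λ ())
enumerate {P} P? (suc n) with P? n | enumerate P? n
... | no _  | g , g-injective , g-below = g , g-injective , map₁ m<n⇒m<1+n ∘ g-below
... | yes p | g , g-injective , g-below = g′ , (λ {i} {j} → g′-injective i j) , g′-below
  where
  g′ : Fin (suc (count P? n)) → ℕ
  g′ zero    = n
  g′ (suc i) = g i
  g′-below : ∀ i → g′ i < suc n × P (g′ i)
  g′-below zero    = ≤-refl , p
  g′-below (suc i) = map₁ m<n⇒m<1+n (g-below i)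
  g′-injective : ∀ i j → g′ i ≡ g′ j → i ≡ j
  g′-injective zero    zero    _  = refl
  g′-injective zero    (suc j) eq = contradiction eq (>⇒≢ (proj₁ (g-below j)))
  g′-injective (suc i) zero    eq = contradiction eq (<⇒≢ (proj₁ (g-below i)))
  g′-injective (suc i) (suc j) eq = cong suc (g-injective eq)

enumerate-≤ : {P : Pred ℕ 0ℓ} (P? : Decidable P) → ∀ {m} n → m ≤ count P? n → Enumeration P m n
enumerate-≤ P? n m≤count with enumerate P? n
... | g , g-injective , g-below =
  g ∘ restrict , (λ {i} {j} → inject≤-injective _ _ i j ∘ g-injective) , g-below ∘ restrict
  where restrict = λ i → inject≤ i m≤count

module DoubleCounting
  {M : Pred ℕ 0ℓ} (M? : Decidable M) {Q : ℕ → ℕ → Set} (Q? : ∀ i j → Dec (Q i j)) {n a b : ℕ}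
  (few-non-Q-below : ∀ {j} → j < n → M j → count (λ i → M? i ×-dec i <? j ×-dec ¬? (Q? i j)) n ≤ a)
  (few-Q-above     : ∀ {i} → i < n → M i → count (λ j → M? j ×-dec i <? j ×-dec Q? i j) n ≤ b)
  where

  rank : ℕ → ℕ
  rank = count M?

  edge? : ∀ i j → Dec (M i × M j × i < j × Q i j)
  edge? i j = M? i ×-dec M? j ×-dec i <? j ×-dec Q? i j

  in-degree out-degree : ℕ → ℕ
  in-degree  j = count (λ i → edge? i j) n
  out-degree i = count (edge? i) n

  rank∸a≤in-degree : ∀ {j} → j < n → M j → rank j ∸ a ≤ in-degree j
  rank∸a≤in-degree {j} j<n mj = m≤n+o⇒m∸n≤o (rank j) a (begin
    rank j                              ≡⟨ count-below M? (<⇒≤ j<n) ⟨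
    count below? n                      ≤⟨ count-by-cases below? (λ i → Q? i j) (λ i → edge? i j) non-Q-below?
                                             (λ (mi , i<j) q → mi , mj , i<j , q)
                                             (λ (mi , i<j) ¬q → mi , i<j , ¬q) n ⟩
    in-degree j + count non-Q-below? n  ≤⟨ +-monoʳ-≤ (in-degree j) (few-non-Q-below j<n mj) ⟩
    in-degree j + a                     ≡⟨ +-comm (in-degree j) a ⟩
    a + in-degree j                     ∎)
    where
    open ≤-Reasoning
    below? non-Q-below? : Decidable _
    below?       i = M? i ×-dec i <? j
    non-Q-below? i = M? i ×-dec i <? j ×-dec ¬? (Q? i j)

  count-later-members : ∀ {i} → i < n → M i →
    count (λ j → M? j ×-dec ¬? (j <? suc i)) n ≡ rank n ∸ suc (rank i)
  count-later-members {i} i<n mi = sym (begin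
    rank n ∸ suc (rank i)                  ≡⟨ cong (_∸ suc (rank i)) (count-split M? (_<? suc i) n) ⟩
    earlier + later ∸ suc (rank i)         ≡⟨ cong (λ e → e + later ∸ suc (rank i)) earlier≡1+rank ⟩
    suc (rank i) + later ∸ suc (rank i)    ≡⟨ m+n∸m≡n (suc (rank i)) later ⟩
    later                                  ∎)
    where
    open ≡-Reasoning
    earlier = count (λ j → M? j ×-dec j <? suc i) n
    later   = count (λ j → M? j ×-dec ¬? (j <? suc i)) n
    earlier≡1+rank : earlier ≡ suc (rank i)
    earlier≡1+rank = trans (count-below M? i<n) (cong (_+ rank i) (𝟙-yes (M? i) mi))

  out-degree≤b⊓later : ∀ {i} → i < n → M i → out-degree i ≤ b ⊓ (rank n ∸ suc (rank i))
  out-degree≤b⊓later {i} i<n mi = ⊓-glb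
    (≤-trans (count-mono (edge? i) (λ j → M? j ×-dec i <? j ×-dec Q? i j)
                         (λ (_ , mj , i<j , q) → mj , i<j , q) n)
             (few-Q-above i<n mi))
    (≤-trans (count-mono (edge? i) (λ j → M? j ×-dec ¬? (j <? suc i))
                         (λ (_ , mj , i<j , _) → mj , <⇒≱ i<j ∘ s≤s⁻¹) n)
             (≤-reflexive (count-later-members i<n mi)))

  ∑-rank∸a≤∑-b⊓rank : ∑[ t < rank n ] (t ∸ a) ≤ ∑[ t < rank n ] (b ⊓ t)
  ∑-rank∸a≤∑-b⊓rank = begin
    ∑[ t < rank n ] (t ∸ a)
      ≡⟨ ∑-members-by-rank M? (_∸ a) n ⟨
    ∑[ j < n ] (𝟙 (M? j) * (rank j ∸ a))
      ≤⟨ ∑-mono-≤ n (λ j<n → 𝟙*-≤ (M? _) (rank∸a≤in-degree j<n)) ⟩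
    ∑[ j < n ] in-degree j
      ≡⟨ ∑-comm n n (λ j i → 𝟙 (edge? i j)) ⟩
    ∑[ i < n ] out-degree i
      ≤⟨ ∑-mono-≤ n (λ i<n → ≤-𝟙* (M? _) (out-degree≤b⊓later i<n) no-out-edges) ⟩
    ∑[ i < n ] (𝟙 (M? i) * (b ⊓ (rank n ∸ suc (rank i))))
      ≡⟨ ∑-members-by-rank M? (λ t → b ⊓ (rank n ∸ suc t)) n ⟩
    ∑[ t < rank n ] (b ⊓ (rank n ∸ suc t))
      ≡⟨ ∑-reverse (rank n) (b ⊓_) ⟩
    ∑[ t < rank n ] (b ⊓ t)
      ∎
    where
    open ≤-Reasoning
    no-out-edges : ∀ {i} → ¬ M i → out-degree i ≡ 0
    no-out-edges ¬mi = count-none (edge? _) (¬mi ∘ proj₁) n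

  size-bound : ∀ {k} → 2 * (a * b) < suc k * suc (suc k) → rank n ≤ a + b + suc k
  size-bound ab<k₁k₂ = ∑∸≤∑⊓⇒p≤a+b+1+k ab<k₁k₂ ∑-rank∸a≤∑-b⊓rank

module Monochromatic (N : ℕ) .{{_ : NonZero N}} (c : Colouring N) where

  -- Only arguments below N are meaningful: larger ones are reduced modulo N.
  col : ℕ → ℕ → Bool
  col x y = c (x mod N) (y mod N)

  Path : Bool → Bool → ℕ → ℕ → Pred ℕ 0ℓ
  Path t u x z y = x < y × y < z × col x y ≡ t × col y z ≡ u

  path? : ∀ t u x z → Decidable (Path t u x z)
  path? t u x z y = x <? y ×-dec y <? z ×-dec col x y ≟ t ×-dec col y z ≟ u

  middles : Bool → ℕ → ℕ → ℕ
  middles t x z = count (path? t t x z) N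

  toℕ-mod : ∀ {x} → x < N → toℕ (x mod N) ≡ x
  toℕ-mod x<N = trans (toℕ-fromℕ< _) (m<n⇒m%n≡m x<N)

  diamond-from-middles : ∀ {t m x z} → z < N → suc m ≤ middles t x z → DiamondCopy (suc m) N c t
  diamond-from-middles {t} {m} {x} {z} z<N m<middles with enumerate-≤ (path? t t x z) N m<middles
  ... | g , g-injective , g-middle = record
    { f     = f
    ; inj   = λ {u} {v} → position-injective u v ∘ f-position-≡ u v
    ; mono₁ = λ i → f-≤ bot (mid i) (<⇒≤ (x<g i))
    ; mono₂ = λ i → f-≤ (mid i) top (<⇒≤ (g<z i))
    ; edge₁ = λ i → proj₁ (proj₂ (proj₂ (proj₂ (g-middle i))))
    ; edge₂ = λ i → proj₂ (proj₂ (proj₂ (proj₂ (g-middle i))))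
    }
    where
    x<g : ∀ i → x < g i
    x<g i = proj₁ (proj₂ (g-middle i))
    g<z : ∀ i → g i < z
    g<z i = proj₁ (proj₂ (proj₂ (g-middle i)))
    x<z : x < z
    x<z = <-trans (x<g zero) (g<z zero)

    position : DiamondV (suc m) → ℕ
    position bot     = x
    position (mid i) = g i
    position top     = z

    position-injective : ∀ u v → position u ≡ position v → u ≡ v
    position-injective bot     bot     _  = refl
    position-injective (mid i) (mid j) eq = cong mid (g-injective eq)
    position-injective top     top     _  = refl
    position-injective bot     (mid j) eq = contradiction eq (<⇒≢ (x<g j))
    position-injective bot     top     eq = contradiction eq (<⇒≢ x<z)
    position-injective (mid i) bot     eq = contradiction eq (>⇒≢ (x<g i))
    position-injective (mid i) top     eq = contradiction eq (<⇒≢ (g<z i))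
    position-injective top     bot     eq = contradiction eq (>⇒≢ x<z)
    position-injective top     (mid j) eq = contradiction eq (>⇒≢ (g<z j))

    position<N : ∀ v → position v < N
    position<N bot     = <-trans x<z z<N
    position<N (mid i) = <-trans (g<z i) z<N
    position<N top     = z<N

    f : DiamondV (suc m) → Fin N
    f v = position v mod N

    toℕ-f : ∀ v → toℕ (f v) ≡ position v
    toℕ-f v = toℕ-mod (position<N v)

    f-position-≡ : ∀ u v → f u ≡ f v → position u ≡ position v
    f-position-≡ u v eq = trans (sym (toℕ-f u)) (trans (cong toℕ eq) (toℕ-f v))

    f-≤ : ∀ u v → position u ≤ position v → toℕ (f u) ≤ toℕ (f v)
    f-≤ u v = subst₂ _≤_ (sym (toℕ-f u)) (sym (toℕ-f v))

  diamond-or-few-middles : ∀ t m →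
    DiamondCopy (suc m) N c t ⊎ (∀ {x z} → x < N → z < N → middles t x z ≤ m)
  diamond-or-few-middles t m with anyUpTo? (λ x → anyUpTo? (λ z → m <? middles t x z) N) N
  ... | yes (_ , _ , _ , z<N , many) = inj₁ (diamond-from-middles z<N many)
  ... | no none                      = inj₂ λ x<N z<N → ≮⇒≥ λ many → none (_ , x<N , _ , z<N , many)

module DiamondFree (top : ℕ) (c : Colouring (suc top)) where

  N : ℕ
  N = suc top

  open Monochromatic N c

  inner? : Decidable (λ y → 0 < y × y < top)
  inner? y = 0 <? y ×-dec y <? top

  inner-count : count inner? N ≡ top ∸ 1
  inner-count = trans (count-below (0 <?_) (n≤1+n top)) (count-positive top)

  inner-by-colours : count inner? N ≤
    (middles true 0 top + count (path? true false 0 top) N) + (count (path? false true 0 top) N + middles false 0 top)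
  inner-by-colours = ≤-trans
    (count-by-cases inner? (λ y → col 0 y ≟ true) (first? true) (first? false)
                    (λ (0<y , y<top) c₀ → 0<y , y<top , c₀)
                    (λ (0<y , y<top) ¬c₀ → 0<y , y<top , ¬-not ¬c₀) N)
    (+-mono-≤ (by-last true) (by-last false))
    where
    first? : ∀ t → Decidable (λ y → 0 < y × y < top × col 0 y ≡ t)
    first? t y = 0 <? y ×-dec y <? top ×-dec col 0 y ≟ t
    by-last : ∀ t → count (first? t) N ≤ count (path? t true 0 top) N + count (path? t false 0 top) N
    by-last t = count-by-cases (first? t) (λ y → col y top ≟ true) (path? t true 0 top) (path? t false 0 top)
                  (λ (0<y , y<top , c₀) c₁ → 0<y , y<top , c₀ , c₁)
                  (λ (0<y , y<top , c₀) ¬c₁ → 0<y , y<top , c₀ , ¬-not ¬c₁) N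

  mixed-bound : ∀ t {α β k} → 2 * (α * β) < suc k * suc (suc k) →
    (∀ {x z} → x < N → z < N → middles t x z ≤ α) →
    (∀ {x z} → x < N → z < N → middles (not t) x z ≤ β) →
    count (path? t (not t) 0 top) N ≤ α + β + suc k
  mixed-bound t {α} {β} αβ<k₁k₂ few-t few-not-t =
    DoubleCounting.size-bound (path? t (not t) 0 top) (λ i j → col i j ≟ not t)
                              few-t-below few-not-t-above αβ<k₁k₂
    where
    ≢not⇒≡ : ∀ {u} → u ≢ not t → u ≡ t
    ≢not⇒≡ u≢ = trans (¬-not u≢) (not-involutive t)
    mixed-before? : ∀ j → Decidable (λ i → Path t (not t) 0 top i × i < j × col i j ≢ not t)
    mixed-before? j i = path? t (not t) 0 top i ×-dec i <? j ×-dec ¬? (col i j ≟ not t)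
    mixed-after? : ∀ i → Decidable (λ j → Path t (not t) 0 top j × i < j × col i j ≡ not t)
    mixed-after? i j = path? t (not t) 0 top j ×-dec i <? j ×-dec col i j ≟ not t
    few-t-below : ∀ {j} → j < N → Path t (not t) 0 top j → count (mixed-before? j) N ≤ α
    few-t-below {j} j<N _ = ≤-trans
      (count-mono (mixed-before? j) (path? t t 0 j)
                  (λ ((0<i , _ , c₀ᵢ , _) , i<j , ¬cᵢⱼ) → 0<i , i<j , c₀ᵢ , ≢not⇒≡ ¬cᵢⱼ) N)
      (few-t z<s j<N)
    few-not-t-above : ∀ {i} → i < N → Path t (not t) 0 top i → count (mixed-after? i) N ≤ β
    few-not-t-above {i} i<N _ = ≤-trans
      (count-mono (mixed-after? i) (path? (not t) (not t) i top)
                  (λ ((_ , j<top , _ , cⱼₜ) , i<j , cᵢⱼ) → i<j , j<top , cᵢⱼ , cⱼₜ) N)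
      (few-not-t i<N ≤-refl)

  diamond-free-bound : ∀ {a b k} → 2 * (a * b) < suc k * suc (suc k) →
    (∀ {x z} → x < N → z < N → middles true x z ≤ a) →
    (∀ {x z} → x < N → z < N → middles false x z ≤ b) →
    top ∸ 1 ≤ (a + (a + b + suc k)) + ((b + a + suc k) + b)
  diamond-free-bound {a} {b} {k} ab<k₁k₂ few-red few-blue = begin
    top ∸ 1
      ≡⟨ inner-count ⟨
    count inner? N
      ≤⟨ inner-by-colours ⟩
    (middles true 0 top + count (path? true false 0 top) N) + (count (path? false true 0 top) N + middles false 0 top)
      ≤⟨ +-mono-≤ (+-mono-≤ (few-red z<s ≤-refl) (mixed-bound true ab<k₁k₂ few-red few-blue))
                  (+-mono-≤ (mixed-bound false ba<k₁k₂ few-blue few-red) (few-blue z<s ≤-refl)) ⟩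
    (a + (a + b + suc k)) + ((b + a + suc k) + b)
      ∎
    where
    open ≤-Reasoning
    ba<k₁k₂ : 2 * (b * a) < suc k * suc (suc k)
    ba<k₁k₂ = subst (λ ab → 2 * ab < suc k * suc (suc k)) (*-comm a b) ab<k₁k₂

theorem3p8 : (r s : ℕ) → 2 ≤ r → 2 ≤ s → (k : ℕ) → IsTriFloor ((r ∸ 1) * (s ∸ 1)) k →
    CR²≤ r s (2 * k + 3 * (r + s) ∸ 1)
theorem3p8 (suc a) (suc b) (s≤s _) (s≤s _) k (_ , ab<k₁k₂) = suc (suc m) , ≤-reflexive size , arrows
  where
  m : ℕ
  m = 2 * k + 3 * (a + b) + 3
  expand : ∀ a b k → 2 * k + 3 * (suc a + suc b) ≡ 3 + (2 * k + 3 * (a + b) + 3)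
  expand = solve-∀
  size : suc (suc m) ≡ 2 * k + 3 * (suc a + suc b) ∸ 1
  size = sym (cong (_∸ 1) (expand a b k))
  m-exceeds : ∀ a b k → 2 * k + 3 * (a + b) + 3 ≡ suc ((a + (a + b + suc k)) + ((b + a + suc k) + b))
  m-exceeds = solve-∀
  arrows : Arrows (suc a) (suc b) (suc (suc m))
  arrows c with Monochromatic.diamond-or-few-middles (suc (suc m)) c true a
              | Monochromatic.diamond-or-few-middles (suc (suc m)) c false b
  ... | inj₁ red     | _             = inj₁ red
  ... | inj₂ _       | inj₁ blue     = inj₂ blue
  ... | inj₂ few-red | inj₂ few-blue =
    contradiction (DiamondFree.diamond-free-bound (suc m) c ab<k₁k₂ few-red few-blue)
                  (<⇒≱ (≤-reflexive (sym (m-exceeds a b k))))
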